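{- Let $A$ be a System T type, $d\in\mathcal{D}_{\mathbb N}\mathbb{N}$, and $g_1,g_2:\mathbb{N}\to\mathbb{N}$ with $g_1\approx_{\iota\Rightarrow\iota}g_2$. Then $\mathsf{enc}_A(\mathsf{map}\,g_2\,d)\approx_{\mathsf{ChD}_A(\iota)}[\![\mathsf{map}_A]\!]\,g_1\,(\mathsf{enc}_A\,d)$.
   Context: Metatheory: constructive Martin-Löf type theory without function extensionality. System T types: base $\iota$ and $\sigma\Rightarrow\tau$; standard terms and set interpretation $[\![\iota]\!]=\mathbb{N}$, $[\![\sigma\Rightarrow\tau]\!]=[\![\sigma]\!]\to[\![\tau]\!]$. Hereditarily extensional equality: $n\approx_\iota m$ iff $n=m$; $f\approx_{\sigma_1\Rightarrow\sigma_2}g$ iff $\forall x,y$, $x\approx_{\sigma_1}y\Rightarrow f\,x\approx_{\sigma_2}g\,y$ (so $g_1\approx_{\iota\Rightarrow\iota}g_2$ means $g_1\,n=g_2\,n$ for all $n$). Dialogue trees $\mathcal{D}_{\mathbb N}\mathbb{N}$: inductive, constructors $\eta\,n$ and $\beta\,\varphi\,i$. Kleisli extension: $f^\sharp(\eta\,x)=f\,x$, $f^\sharp(\beta\,\varphi\,i)=\beta\,(\lambda o.f^\sharp(\varphi\,o))\,i$; $\mathsf{map}\,g:=(\eta\circ g)^\sharp$. Internal trees: $\mathsf{ChD}_A(\sigma):=(\sigma\Rightarrow A)\Rightarrow((\iota\Rightarrow A)\Rightarrow\iota\Rightarrow A)\Rightarrow A$; $\eta_A:=\lambda z\,e\,b.\,e\,z$;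 $\beta_A:=\lambda\varphi\,x\,e\,b.\,b\,(\lambda y.\varphi\,y\,e\,b)\,x$; $K_A:=\lambda f\,d\,e'\,b'.\,d\,(\lambda x.f\,x\,e'\,b')\,b'$; $\mathsf{map}_A:=\lambda f.\,K_A(\lambda x.\eta_A(f\,x))$, a closed term of type $(\iota\Rightarrow\iota)\Rightarrow\mathsf{ChD}_A(\iota)\Rightarrow\mathsf{ChD}_A(\iota)$. Encoding $\mathsf{enc}_A(\eta\,z)=[\![\eta_A]\!]\,z$, $\mathsf{enc}_A(\beta\,\varphi\,x)=[\![\beta_A]\!]\,(\mathsf{enc}_A\circ\varphi)\,x$. -}

module Defs where

open import Data.Nat using (ℕ; zero; suc)
open import Data.List using (List; []; _∷_)
open import Relation.Binary.PropositionalEquality using (_≡_)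

infixr 5 _⇒_

data Ty : Set where
  ι   : Ty
  _⇒_ : Ty → Ty → Ty

⟦_⟧ty : Ty → Set
⟦ ι ⟧ty     = ℕ
⟦ σ ⇒ τ ⟧ty = ⟦ σ ⟧ty → ⟦ τ ⟧ty

Ext : (σ : Ty) → ⟦ σ ⟧ty → ⟦ σ ⟧ty → Set
Ext ι n m         = n ≡ m
Ext (σ ⇒ τ) f g   = ∀ x y → Ext σ x y → Ext τ (f x) (g y)

Cxt : Set
Cxt = List Ty

data _∋_ : Cxt → Ty → Set where
  here  : ∀ {Γ σ} → (σ ∷ Γ) ∋ σ
  there : ∀ {Γ σ τ} → Γ ∋ σ → (τ ∷ Γ) ∋ σ

data Tm (Γ : Cxt) : Ty → Set where
  var  : ∀ {σ} → Γ ∋ σ → Tm Γ σ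
  lam  : ∀ {σ τ} → Tm (σ ∷ Γ) τ → Tm Γ (σ ⇒ τ)
  app  : ∀ {σ τ} → Tm Γ (σ ⇒ τ) → Tm Γ σ → Tm Γ τ
  zer  : Tm Γ ι
  suc' : Tm Γ ι → Tm Γ ι
  rec  : ∀ {σ} → Tm Γ (ι ⇒ σ ⇒ σ) → Tm Γ σ → Tm Γ ι → Tm Γ σ

data Env : Cxt → Set where
  []  : Env []
  _∷_ : ∀ {σ Γ} → ⟦ σ ⟧ty → Env Γ → Env (σ ∷ Γ)

lookupEnv : ∀ {Γ σ} → Env Γ → Γ ∋ σ → ⟦ σ ⟧ty
lookupEnv (x ∷ ρ) here      = x
lookupEnv (x ∷ ρ) (there i) = lookupEnv ρ i

iter : {X : Set} → (ℕ → X → X) → X → ℕ → X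
iter f x zero    = x
iter f x (suc n) = f n (iter f x n)

⟦_⟧tm : ∀ {Γ σ} → Tm Γ σ → Env Γ → ⟦ σ ⟧ty
⟦ var i ⟧tm ρ     = lookupEnv ρ i
⟦ lam t ⟧tm ρ     = λ x → ⟦ t ⟧tm (x ∷ ρ)
⟦ app t u ⟧tm ρ   = ⟦ t ⟧tm ρ (⟦ u ⟧tm ρ)
⟦ zer ⟧tm ρ       = zero
⟦ suc' t ⟧tm ρ    = suc (⟦ t ⟧tm ρ)
⟦ rec f a n ⟧tm ρ = iter (⟦ f ⟧tm ρ) (⟦ a ⟧tm ρ) (⟦ n ⟧tm ρ)

⟦_⟧ : ∀ {σ} → Tm [] σ → ⟦ σ ⟧ty
⟦ t ⟧ = ⟦ t ⟧tm []

data D : Set where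
  η : ℕ → D
  β : (ℕ → D) → ℕ → D

_♯ : (ℕ → D) → D → D
(f ♯) (η x)   = f x
(f ♯) (β φ i) = β (λ o → (f ♯) (φ o)) i

mapD : (ℕ → ℕ) → D → D
mapD g = (λ x → η (g x)) ♯

ChD : Ty → Ty → Ty
ChD A σ = (σ ⇒ A) ⇒ ((ι ⇒ A) ⇒ ι ⇒ A) ⇒ A

v0 : ∀ {Γ σ} → Tm (σ ∷ Γ) σ
v0 = var here
v1 : ∀ {Γ σ τ} → Tm (τ ∷ σ ∷ Γ) σ
v1 = var (there here)
v2 : ∀ {Γ σ τ ρ} → Tm (ρ ∷ τ ∷ σ ∷ Γ) σ
v2 = var (there (there here))
v3 : ∀ {Γ σ τ ρ κ} → Tm (κ ∷ ρ ∷ τ ∷ σ ∷ Γ) σ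
v3 = var (there (there (there here)))
v4 : ∀ {Γ σ τ ρ κ μ} → Tm (μ ∷ κ ∷ ρ ∷ τ ∷ σ ∷ Γ) σ
v4 = var (there (there (there (there here))))

-- η_A := λ z e b. e z
ηT : (A : Ty) → Tm [] (ι ⇒ ChD A ι)
ηT A = lam (lam (lam (app v1 v2)))

-- β_A := λ φ x e b. b (λ y. φ y e b) x
βT : (A : Ty) → Tm [] ((ι ⇒ ChD A ι) ⇒ ι ⇒ ChD A ι)
βT A = lam (lam (lam (lam
         (app (app v0 (lam (app (app (app v4 v0) v2) v1))) v2))))

-- K_A := λ f d e' b'. d (λ x. f x e' b') b'
KT : (A : Ty) → Tm [] ((ι ⇒ ChD A ι) ⇒ ChD A ι ⇒ ChD A ι)
KT A = lam (lam (lam (lam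
         (app (app v2 (lam (app (app (app v4 v0) v2) v1))) v0))))

-- map_A := λ f. K_A (λ x. η_A (f x))
wk : ∀ {Γ σ τ} → Tm [] σ → Tm (τ ∷ Γ) σ
wk t = closedWk t
  where
  ren : ∀ {Δ Δ' σ} → (∀ {ρ} → Δ ∋ ρ → Δ' ∋ ρ) → Tm Δ σ → Tm Δ' σ
  ren r (var i)     = var (r i)
  ren r (lam t)     = lam (ren (λ { here → here ; (there i) → there (r i) }) t)
  ren r (app t u)   = app (ren r t) (ren r u)
  ren r zer         = zer
  ren r (suc' t)    = suc' (ren r t)
  ren r (rec f a n) = rec (ren r f) (ren r a) (ren r n)
  closedWk : ∀ {σ} → Tm [] σ → Tm _ σ
  closedWk = ren (λ ())

mapT : (A : Ty) → Tm [] ((ι ⇒ ι) ⇒ ChD A ι ⇒ ChD A ι)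
mapT A = lam (app (wk (KT A)) (lam (app (wk (ηT A)) (app v1 v0))))

enc : (A : Ty) → D → ⟦ ChD A ι ⟧ty
enc A (η z)   = ⟦ ηT A ⟧ z
enc A (β φ x) = ⟦ βT A ⟧ (λ o → enc A (φ o)) x

{-# OPTIONS --safe #-}
module Submission where

open import Defs
open import Relation.Binary.PropositionalEquality using (refl; sym)

-- ⟦ mapT A ⟧ g t computes to λ e b → t (λ x → e (g x)) b, so both sides unfold along d in lockstep.
corollary31 : (A : Ty) (d : D) (g₁ g₂ : ⟦ ι ⇒ ι ⟧ty) → Ext (ι ⇒ ι) g₁ g₂ →
                  Ext (ChD A ι) (enc A (mapD g₂ d)) (⟦ mapT A ⟧ g₁ (enc A d))
corollary31 A (η z) g₁ g₂ g₁≈g₂ e₁ e₂ e₁≈e₂ b₁ b₂ b₁≈b₂ =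
  e₁≈e₂ (g₂ z) (g₁ z) (sym (g₁≈g₂ z z refl))
corollary31 A (β φ x) g₁ g₂ g₁≈g₂ e₁ e₂ e₁≈e₂ b₁ b₂ b₁≈b₂ =
  b₁≈b₂ _ _ branches≈ x x refl
  where
  branches≈ : Ext (ι ⇒ A) (λ y → enc A (mapD g₂ (φ y)) e₁ b₁)
                          (λ y → enc A (φ y) (λ o → e₂ (g₁ o)) b₂)
  branches≈ y .y refl = corollary31 A (φ y) g₁ g₂ g₁≈g₂ e₁ e₂ e₁≈e₂ b₁ b₂ b₁≈b₂
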